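{- Consider an infinite-step CGK random walk on strings $x,y$, with pointers $p_t$ on $x$ and $q_t$ on $y$ at the beginning of step $t$. Let $u$ be an index and let $U,V\ge u-1$ be any integers. Then: (1) if $T_0$ is the first time with $p_{T_0}\ge u$, then $\mathbb{E}[|p_{T_0}-q_{T_0}|]\le 4\cdot\mathsf{ed}(x[1..U],y[1..V])$; (2) if $T_1$ is the first time with $p_{T_1}\ge u$ and $q_{T_1}\ge u$, then $\mathbb{E}[|p_{T_1}-q_{T_1}|]\le 4\cdot\mathsf{ed}(x[1..U],y[1..V])$.
   Context: CGK random walk on $x,y\in\Sigma^n$: both strings are appended with infinitely many zeros ($0\in\Sigma$). Pointers start at $p_1=q_1=1$. At each step $t=1,2,\dots$, using a shared uniformly random function $r(t,\cdot):\Sigma\to\{0,1\}$ (independent over $t$), update $p_{t+1}=p_t+r(t,x[p_t])$ and $q_{t+1}=q_t+r(t,y[q_t])$. $\mathsf{ed}$ denotes edit distance; $x[1..U]$ is the prefix of the padded string of length $U$. -}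

module Defs where

open import Data.Nat using (ℕ; zero; suc; _+_; _*_; _∸_; _^_; _≤_; _≤ᵇ_; _⊔_; _⊓_; ∣_-_∣)
open import Data.Bool using (Bool; true; false; if_then_else_; _∧_)
open import Data.Fin using (Fin) renaming (zero to fzero)
open import Data.Fin.Properties using () renaming (_≟_ to _≟ᶠ_)
open import Data.Vec using (Vec; []; _∷_; lookup)
open import Data.List using (List; []; _∷_; length; map; concatMap)
open import Data.Nat.ListAction using (sum)
open import Relation.Nullary.Decidable using (⌊_⌋)

-- Alphabet Σ = Fin (suc k); the symbol 0 ∈ Σ is fzero.

-- Padded string, 1-based: pad x i = x[i] for 1 ≤ i ≤ n, and 0 otherwise
-- (index 0 is never read by the walk).
pad : ∀ {k n} → Vec (Fin (suc k)) n → ℕ → Fin (suc k)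
pad []       _             = fzero
pad (a ∷ as) zero          = fzero
pad (a ∷ as) (suc zero)    = a
pad (a ∷ as) (suc (suc i)) = pad as (suc i)

prefix : ∀ {k n} → Vec (Fin (suc k)) n → ℕ → List (Fin (suc k))
prefix x U = go 1 U
  where
  go : ℕ → ℕ → List _
  go i zero    = []
  go i (suc m) = pad x i ∷ go (suc i) m

ed : ∀ {k} → List (Fin (suc k)) → List (Fin (suc k)) → ℕ
edRow : ∀ {k} → Fin (suc k) → List (Fin (suc k)) → List (Fin (suc k)) → ℕ
ed []       bs = length bs
ed (a ∷ as) bs = edRow a as bs
edRow a as []       = suc (length as)
edRow a as (b ∷ bs) =
  suc (ed as (b ∷ bs)) ⊓ (suc (edRow a as bs) ⊓ ((if ⌊ a ≟ᶠ b ⌋ then 0 else 1) + ed as bs))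

-- One random function r(t,·) : Σ → {0,1} is a vector of bits indexed by Σ.
Step : ℕ → Set
Step k = Vec Bool (suc k)

bit : Bool → ℕ
bit true  = 1
bit false = 0

-- Run the CGK walk from pointers (p , q) with the given sequence of random
-- functions r(t,·), t = 1, 2, ….  At the beginning of each step the stopping
-- condition `stop p q` is tested; at the first time it holds, the value
-- |p - q| is returned.  If it does not hold at any of the times
-- 1, …, N+1 (N = number of steps supplied), the value 0 is returned.
-- So the result is  |p_T - q_T| · 1{T ≤ N+1}.
hitValue : ∀ {k n} → (ℕ → ℕ → Bool) → Vec (Fin (suc k)) n → Vec (Fin (suc k)) n →
           ℕ → ℕ → List (Step k) → ℕ
hitValue stop x y p q [] = if stop p q then ∣ p - q ∣ else 0
hitValue stop x y p q (r ∷ rs) =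
  if stop p q then ∣ p - q ∣
  else hitValue stop x y (p + bit (lookup r (pad x p))) (q + bit (lookup r (pad y q))) rs

allBits : (m : ℕ) → List (Vec Bool m)
allBits zero    = [] ∷ []
allBits (suc m) = concatMap (λ v → (false ∷ v) ∷ (true ∷ v) ∷ []) (allBits m)

sequences : {A : Set} → ℕ → List A → List (List A)
sequences zero    as = [] ∷ []
sequences (suc N) as = concatMap (λ a → map (a ∷_) (sequences N as)) as

-- (2^{|Σ|})^N · E[ |p_T - q_T| · 1{T ≤ N+1} ] for the walk started at p_1 = q_1 = 1,
-- where r(1,·), …, r(N,·) are uniform and independent: summed over all
-- (2^{|Σ|})^N equally likely choices.
scaledTruncExp : ∀ {k n} → (ℕ → ℕ → Bool) → Vec (Fin (suc k)) n → Vec (Fin (suc k)) n → ℕ → ℕ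
scaledTruncExp {k} stop x y N = sum (map (hitValue stop x y 1 1) (sequences N (allBits (suc k))))

stop₀ : ℕ → ℕ → ℕ → Bool
stop₀ u p q = u ≤ᵇ p

stop₁ : ℕ → ℕ → ℕ → Bool
stop₁ u p q = (u ≤ᵇ p) ∧ (u ≤ᵇ q)

{-# OPTIONS --safe #-}
module Submission where

-- Let D(p, j) = ed(x[p..U], y[j..V]) and Φ(p, q, j) = |p − j| + |q − j| + 2·D(p, j), where j is
-- the position of y that x[p] is currently aligned with.  Reading off the first edit of an
-- optimal alignment of x[p..U] with y[j..V], one can re-choose j after every step of the walk so
-- that min_j Φ is a supermartingale: leading insertions only lower Φ; if x[p] is deleted, j stays
-- and the unit drop of D pays for the pointer moves; if x[p] is aligned with y[j], j advances
-- with p, and on a mismatch the four equally likely moves keep Φ in expectation except when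
-- q = j, where the alignment must substitute and D drops.  The walk never stops while a pointer
-- is inside its prefix, and when it stops |p − q| ≤ Φ.  Hence the expectation is at most
-- Φ(1, 1, 1) = 2·ed(x[1..U], y[1..V]).

open import Defs
open import Data.Nat
  using (ℕ; zero; suc; _+_; _*_; _∸_; _^_; _≤_; _<_; _≤ᵇ_; _⊓_; ∣_-_∣; z≤n; s≤s)
open import Data.Nat.Properties
open import Data.Nat.ListAction using (sum)
open import Data.Nat.ListAction.Properties using (sum-++)
open import Data.Nat.Tactic.RingSolver using (solve-∀)
open import Data.Bool using (Bool; true; false; if_then_else_; T)
open import Data.Fin using (Fin) renaming (zero to fzero; suc to fsuc)
open import Data.Fin.Properties using () renaming (_≟_ to _≟ᶠ_)
open import Data.Vec using (Vec; []; _∷_; lookup)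
open import Data.List using (List; []; _∷_; length; map; concatMap; _++_)
open import Data.List.Properties using (length-++; length-map; map-++; map-cong; map-∘)
open import Data.Product using (Σ-syntax; _×_; _,_)
open import Data.Sum using (_⊎_; inj₁; inj₂; [_,_])
open import Data.Empty using (⊥-elim)
open import Function using (_∘_; flip)
open import Relation.Binary.PropositionalEquality hiding ([_])
open import Relation.Nullary using (yes; no; contradiction)
open import Relation.Nullary.Decidable using (⌊_⌋)
open import Algebra.Properties.CommutativeSemigroup *-commutativeSemigroup using (x∙yz≈y∙xz)

private
  variable
    A B : Set
    a a′ c c′ d e m n : ℕ

∣1+m-n∣≤1+∣m-n∣ : ∀ m n → ∣ suc m - n ∣ ≤ suc ∣ m - n ∣
∣1+m-n∣≤1+∣m-n∣ zero    zero    = ≤-refl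
∣1+m-n∣≤1+∣m-n∣ zero    (suc n) = ≤-trans (n≤1+n n) (n≤1+n (suc n))
∣1+m-n∣≤1+∣m-n∣ (suc m) zero    = ≤-refl
∣1+m-n∣≤1+∣m-n∣ (suc m) (suc n) = ∣1+m-n∣≤1+∣m-n∣ m n

∣m-1+n∣≤1+∣m-n∣ : ∀ m n → ∣ m - suc n ∣ ≤ suc ∣ m - n ∣
∣m-1+n∣≤1+∣m-n∣ m n = begin
  ∣ m - suc n ∣   ≡⟨ ∣-∣-comm m (suc n) ⟩
  ∣ suc n - m ∣   ≤⟨ ∣1+m-n∣≤1+∣m-n∣ n m ⟩
  suc ∣ n - m ∣   ≡⟨ cong suc (∣-∣-comm n m) ⟩
  suc ∣ m - n ∣   ∎
  where open ≤-Reasoning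

∣m-1+n∣+∣1+m-n∣≡2*∣m-n∣ : ∀ m n → m ≢ n → ∣ m - suc n ∣ + ∣ suc m - n ∣ ≡ 2 * ∣ m - n ∣
∣m-1+n∣+∣1+m-n∣≡2*∣m-n∣ zero    zero    0≢0 = contradiction refl 0≢0
∣m-1+n∣+∣1+m-n∣≡2*∣m-n∣ zero    (suc n) _   = identity n
  where
  identity : ∀ n → suc (suc n) + n ≡ 2 * suc n
  identity = solve-∀
∣m-1+n∣+∣1+m-n∣≡2*∣m-n∣ (suc m) zero    _   rewrite ∣-∣-identityʳ m = identity m
  where
  identity : ∀ m → m + suc (suc m) ≡ 2 * suc m
  identity = solve-∀
∣m-1+n∣+∣1+m-n∣≡2*∣m-n∣ (suc m) (suc n) m≢n =
  ∣m-1+n∣+∣1+m-n∣≡2*∣m-n∣ m n (m≢n ∘ cong suc)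

unit-steps-≤ : a′ ≤ suc a → c′ ≤ suc c → d ≡ suc e → a′ + c′ + 2 * e ≤ a + c + 2 * d
unit-steps-≤ {a′} {a} {c′} {c} {e = e} a′≤ c′≤ refl = begin
  a′ + c′ + 2 * e          ≤⟨ +-monoˡ-≤ (2 * e) (+-mono-≤ a′≤ c′≤) ⟩
  suc a + suc c + 2 * e    ≡⟨ identity a c e ⟩
  a + c + 2 * suc e        ∎
  where
  open ≤-Reasoning
  identity : ∀ a c e → suc a + suc c + 2 * e ≡ a + c + 2 * suc e
  identity = solve-∀

deletion-mean-≤ : a′ ≤ suc a → c′ ≤ suc c → d ≡ suc e →
  (a + c′ + 2 * d) + (a′ + c + 2 * e) + (a′ + c′ + 2 * e) ≤ 3 * (a + c + 2 * d)
deletion-mean-≤ {a′} {a} {c′} {c} {e = e} a′≤ c′≤ refl = begin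
  (a + c′ + 2 * suc e) + (a′ + c + 2 * e) + (a′ + c′ + 2 * e)
    ≤⟨ +-mono-≤ (+-mono-≤ (+-monoˡ-≤ (2 * suc e) (+-monoʳ-≤ a c′≤))
                          (+-monoˡ-≤ (2 * e) (+-monoˡ-≤ c a′≤)))
                (+-monoˡ-≤ (2 * e) (+-mono-≤ a′≤ c′≤)) ⟩
  (a + suc c + 2 * suc e) + (suc a + c + 2 * e) + (suc a + suc c + 2 * e)
    ≡⟨ identity a c e ⟩
  3 * (a + c + 2 * suc e)
    ∎
  where
  open ≤-Reasoning
  identity : ∀ a c e → (a + suc c + 2 * suc e) + (suc a + c + 2 * e) + (suc a + suc c + 2 * e)
                       ≡ 3 * (a + c + 2 * suc e)
  identity = solve-∀

diagonal-mean-≤ : ∀ {c₁ c₂} a → c₁ + c₂ + 4 * e ≤ 2 * c + 4 * d →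
  (a + c₂ + 2 * d) + (a + c₁ + 2 * e) + (a + c + 2 * e) ≤ 3 * (a + c + 2 * d)
diagonal-mean-≤ {e} {c} {d} {c₁} {c₂} a shifts = begin
  (a + c₂ + 2 * d) + (a + c₁ + 2 * e) + (a + c + 2 * e)  ≡⟨ regroup a c c₁ c₂ d e ⟩
  (c₁ + c₂ + 4 * e) + (3 * a + c + 2 * d)              ≤⟨ +-monoˡ-≤ _ shifts ⟩
  (2 * c + 4 * d) + (3 * a + c + 2 * d)                ≡⟨ collect a c d ⟩
  3 * (a + c + 2 * d)                                  ∎
  where
  open ≤-Reasoning
  regroup : ∀ a c c₁ c₂ d e → (a + c₂ + 2 * d) + (a + c₁ + 2 * e) + (a + c + 2 * e)
                              ≡ (c₁ + c₂ + 4 * e) + (3 * a + c + 2 * d)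
  regroup = solve-∀
  collect : ∀ a c d → (2 * c + 4 * d) + (3 * a + c + 2 * d) ≡ 3 * (a + c + 2 * d)
  collect = solve-∀

m≤n⇒n+m≤2*n : m ≤ n → n + m ≤ 2 * n
m≤n⇒n+m≤2*n {n = n} m≤n = +-monoʳ-≤ n (≤-trans m≤n (≤-reflexive (sym (+-identityʳ n))))

m+n+o≤3*k⇒k+m+n+o≤4*k : ∀ k m n o → m + n + o ≤ 3 * k → k + m + n + o ≤ 4 * k
m+n+o≤3*k⇒k+m+n+o≤4*k k m n o ≤3k = begin
  k + m + n + o      ≡⟨ +-assoc (k + m) n o ⟩
  k + m + (n + o)    ≡⟨ +-assoc k m (n + o) ⟩
  k + (m + (n + o))  ≡⟨ cong (k +_) (+-assoc m n o) ⟨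
  k + (m + n + o)    ≤⟨ +-monoʳ-≤ k ≤3k ⟩
  k + 3 * k          ∎
  where open ≤-Reasoning

module _ {f g : A → ℕ} where

  sum-map-mono : (∀ a → f a ≤ g a) → ∀ xs → sum (map f xs) ≤ sum (map g xs)
  sum-map-mono f≤g []       = ≤-refl
  sum-map-mono f≤g (a ∷ xs) = +-mono-≤ (f≤g a) (sum-map-mono f≤g xs)

  sum-map-+ : ∀ xs → sum (map (λ a → f a + g a) xs) ≡ sum (map f xs) + sum (map g xs)
  sum-map-+ []       = refl
  sum-map-+ (a ∷ xs) = begin
    f a + g a + sum (map (λ a → f a + g a) xs)       ≡⟨ cong (f a + g a +_) (sum-map-+ xs) ⟩
    f a + g a + (sum (map f xs) + sum (map g xs))    ≡⟨ regroup (f a) (g a) (sum (map f xs)) _ ⟩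
    f a + sum (map f xs) + (g a + sum (map g xs))    ∎
    where
    open ≡-Reasoning
    regroup : ∀ u v s t → u + v + (s + t) ≡ u + s + (v + t)
    regroup = solve-∀

sum-map-const : ∀ c (xs : List A) → sum (map (λ _ → c) xs) ≡ length xs * c
sum-map-const c []       = refl
sum-map-const c (a ∷ xs) = cong (c +_) (sum-map-const c xs)

sum-map-*ʳ : ∀ (f : A → ℕ) c xs → sum (map (λ a → f a * c) xs) ≡ sum (map f xs) * c
sum-map-*ʳ f c []       = refl
sum-map-*ʳ f c (a ∷ xs) =
  trans (cong (f a * c +_) (sum-map-*ʳ f c xs)) (sym (*-distribʳ-+ c (f a) _))

sum-map-concatMap : ∀ (h : B → ℕ) (g : A → List B) xs →
  sum (map h (concatMap g xs)) ≡ sum (map (λ a → sum (map h (g a))) xs)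
sum-map-concatMap h g []       = refl
sum-map-concatMap h g (a ∷ xs) = begin
  sum (map h (g a ++ concatMap g xs))              ≡⟨ cong sum (map-++ h (g a) _) ⟩
  sum (map h (g a) ++ map h (concatMap g xs))      ≡⟨ sum-++ (map h (g a)) _ ⟩
  sum (map h (g a)) + sum (map h (concatMap g xs))
    ≡⟨ cong (sum (map h (g a)) +_) (sum-map-concatMap h g xs) ⟩
  sum (map h (g a)) + sum (map (λ a → sum (map h (g a))) xs) ∎
  where open ≡-Reasoning

length-concatMap : ∀ (g : A → List B) xs →
  length (concatMap g xs) ≡ sum (map (λ a → length (g a)) xs)
length-concatMap g []       = refl
length-concatMap g (a ∷ xs) =
  trans (length-++ (g a)) (cong (length (g a) +_) (length-concatMap g xs))

length-sequences : ∀ N (xs : List A) → length (sequences N xs) ≡ length xs ^ N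
length-sequences zero    xs = refl
length-sequences (suc N) xs = begin
  length (concatMap (λ a → map (a ∷_) (sequences N xs)) xs)
    ≡⟨ length-concatMap _ xs ⟩
  sum (map (λ a → length (map (a ∷_) (sequences N xs))) xs)
    ≡⟨ cong sum (map-cong (λ a → length-map (λ (s : List _) → a ∷ s) (sequences N xs)) xs) ⟩
  sum (map (λ _ → length (sequences N xs)) xs)
    ≡⟨ sum-map-const _ xs ⟩
  length xs * length (sequences N xs)
    ≡⟨ cong (length xs *_) (length-sequences N xs) ⟩
  length xs * length xs ^ N
    ∎
  where open ≡-Reasoning

sum-map-sequences : ∀ (h : List A → ℕ) N xs →
  sum (map h (sequences (suc N) xs))
    ≡ sum (map (λ a → sum (map (λ s → h (a ∷ s)) (sequences N xs))) xs)
sum-map-sequences h N xs =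
  trans (sum-map-concatMap h _ xs)
        (cong sum (map-cong (λ a → cong sum (sym (map-∘ (sequences N xs)))) xs))

length-allBits : ∀ m → length (allBits m) ≡ 2 ^ m
length-allBits zero    = refl
length-allBits (suc m) = begin
  length (concatMap (λ v → (false ∷ v) ∷ (true ∷ v) ∷ []) (allBits m))
    ≡⟨ length-concatMap _ (allBits m) ⟩
  sum (map (λ _ → 2) (allBits m))  ≡⟨ sum-map-const 2 (allBits m) ⟩
  length (allBits m) * 2           ≡⟨ cong (_* 2) (length-allBits m) ⟩
  2 ^ m * 2                        ≡⟨ *-comm (2 ^ m) 2 ⟩
  2 ^ suc m                        ∎
  where open ≡-Reasoning

sum-map-allBits : ∀ (g : Vec Bool (suc m) → ℕ) →
  sum (map g (allBits (suc m)))
    ≡ sum (map (λ v → g (false ∷ v)) (allBits m)) + sum (map (λ v → g (true ∷ v)) (allBits m))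
sum-map-allBits {m} g = begin
  sum (map g (allBits (suc m)))
    ≡⟨ sum-map-concatMap g _ (allBits m) ⟩
  sum (map (λ v → g (false ∷ v) + (g (true ∷ v) + 0)) (allBits m))
    ≡⟨ cong sum (map-cong (λ v → cong (g (false ∷ v) +_) (+-identityʳ _)) (allBits m)) ⟩
  sum (map (λ v → g (false ∷ v) + g (true ∷ v)) (allBits m))
    ≡⟨ sum-map-+ (allBits m) ⟩
  sum (map (λ v → g (false ∷ v)) (allBits m)) + sum (map (λ v → g (true ∷ v)) (allBits m))
    ∎
  where open ≡-Reasoning

sum-allBits-lookup : ∀ (b : Fin m) (h : Bool → ℕ) →
  2 * sum (map (λ v → h (lookup v b)) (allBits m)) ≡ 2 ^ m * (h false + h true)
sum-allBits-lookup {suc m} fzero h = begin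
  2 * sum (map (λ v → h (lookup v fzero)) (allBits (suc m)))
    ≡⟨ cong (2 *_) (sum-map-allBits {m = m} (λ v → h (lookup v fzero))) ⟩
  2 * (sum (map (λ _ → h false) (allBits m)) + sum (map (λ _ → h true) (allBits m)))
    ≡⟨ cong₂ (λ s t → 2 * (s + t)) (sum-map-const (h false) (allBits m))
                                    (sum-map-const (h true) (allBits m)) ⟩
  2 * (length (allBits m) * h false + length (allBits m) * h true)
    ≡⟨ cong (λ l → 2 * (l * h false + l * h true)) (length-allBits m) ⟩
  2 * (2 ^ m * h false + 2 ^ m * h true)
    ≡⟨ factor (2 ^ m) (h false) (h true) ⟩
  2 * 2 ^ m * (h false + h true)
    ∎
  where
  open ≡-Reasoning
  factor : ∀ l u v → 2 * (l * u + l * v) ≡ 2 * l * (u + v)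
  factor = solve-∀
sum-allBits-lookup {suc m} (fsuc b) h = begin
  2 * sum (map (λ v → h (lookup v (fsuc b))) (allBits (suc m)))
    ≡⟨ cong (2 *_) (sum-map-allBits {m = m} (λ v → h (lookup v (fsuc b)))) ⟩
  2 * (s + s)                    ≡⟨ double s ⟩
  2 * (2 * s)                    ≡⟨ cong (2 *_) (sum-allBits-lookup b h) ⟩
  2 * (2 ^ m * (h false + h true)) ≡⟨ *-assoc 2 (2 ^ m) _ ⟨
  2 * 2 ^ m * (h false + h true)   ∎
  where
  open ≡-Reasoning
  s = sum (map (λ v → h (lookup v b)) (allBits m))
  double : ∀ s → 2 * (s + s) ≡ 2 * (2 * s)
  double = solve-∀

sum-allBits-lookup₂ : ∀ {a b : Fin m} → a ≢ b → (f : Bool → Bool → ℕ) →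
  4 * sum (map (λ v → f (lookup v a) (lookup v b)) (allBits m))
    ≡ 2 ^ m * (f false false + f false true + f true false + f true true)
sum-allBits-lookup₂ {suc m} {fzero}  {fzero}  a≢b f = contradiction refl a≢b
sum-allBits-lookup₂ {suc m} {fzero}  {fsuc b} a≢b f = begin
  4 * sum (map (λ v → f (lookup v fzero) (lookup v (fsuc b))) (allBits (suc m)))
    ≡⟨ cong (4 *_) (sum-map-allBits {m = m} (λ v → f (lookup v fzero) (lookup v (fsuc b)))) ⟩
  4 * (s₀ + s₁)
    ≡⟨ split s₀ s₁ ⟩
  2 * (2 * s₀) + 2 * (2 * s₁)
    ≡⟨ cong₂ (λ u v → 2 * u + 2 * v) (sum-allBits-lookup b (f false))
                                     (sum-allBits-lookup b (f true)) ⟩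
  2 * (2 ^ m * (f false false + f false true)) + 2 * (2 ^ m * (f true false + f true true))
    ≡⟨ factor (2 ^ m) (f false false) (f false true) (f true false) (f true true) ⟩
  2 * 2 ^ m * (f false false + f false true + f true false + f true true) ∎
  where
  open ≡-Reasoning
  s₀ = sum (map (λ v → f false (lookup v b)) (allBits m))
  s₁ = sum (map (λ v → f true (lookup v b)) (allBits m))
  split : ∀ s t → 4 * (s + t) ≡ 2 * (2 * s) + 2 * (2 * t)
  split = solve-∀
  factor : ∀ l u v w z → 2 * (l * (u + v)) + 2 * (l * (w + z)) ≡ 2 * l * (u + v + w + z)
  factor = solve-∀
sum-allBits-lookup₂ {suc m} {fsuc a} {fzero}  a≢b f = begin
  4 * sum (map (λ v → flip f (lookup v fzero) (lookup v (fsuc a))) (allBits (suc m)))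
    ≡⟨ sum-allBits-lookup₂ (≢-sym a≢b) (flip f) ⟩
  2 ^ suc m * (f false false + f true false + f false true + f true true)
    ≡⟨ cong (2 ^ suc m *_) (swap (f false false) (f true false) (f false true) (f true true)) ⟩
  2 ^ suc m * (f false false + f false true + f true false + f true true) ∎
  where
  open ≡-Reasoning
  swap : ∀ u v w z → u + v + w + z ≡ u + w + v + z
  swap = solve-∀
sum-allBits-lookup₂ {suc m} {fsuc a} {fsuc b} a≢b f = begin
  4 * sum (map (λ v → f (lookup v (fsuc a)) (lookup v (fsuc b))) (allBits (suc m)))
    ≡⟨ cong (4 *_) (sum-map-allBits {m = m} (λ v → f (lookup v (fsuc a)) (lookup v (fsuc b)))) ⟩
  4 * (s + s)      ≡⟨ double s ⟩
  2 * (4 * s)      ≡⟨ cong (2 *_) (sum-allBits-lookup₂ (a≢b ∘ cong fsuc) f) ⟩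
  2 * (2 ^ m * t)  ≡⟨ *-assoc 2 (2 ^ m) t ⟨
  2 * 2 ^ m * t    ∎
  where
  open ≡-Reasoning
  s = sum (map (λ v → f (lookup v a) (lookup v b)) (allBits m))
  t = f false false + f false true + f true false + f true true
  double : ∀ s → 4 * (s + s) ≡ 2 * (4 * s)
  double = solve-∀

mean-allBits-≤ : ∀ (α β : Fin m) (g : Bool → Bool → ℕ) {c} →
  (α ≡ β → g false false + g true true ≤ 2 * c) →
  (α ≢ β → g false false + g false true + g true false + g true true ≤ 4 * c) →
  sum (map (λ v → g (lookup v α) (lookup v β)) (allBits m)) ≤ 2 ^ m * c
mean-allBits-≤ {m} α β g {c} same different with α ≟ᶠ β
... | yes refl = *-cancelˡ-≤ 2 (begin
  2 * sum (map (λ v → g (lookup v α) (lookup v α)) (allBits m))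
    ≡⟨ sum-allBits-lookup α (λ b → g b b) ⟩
  2 ^ m * (g false false + g true true)
    ≤⟨ *-monoʳ-≤ (2 ^ m) (same refl) ⟩
  2 ^ m * (2 * c)
    ≡⟨ x∙yz≈y∙xz (2 ^ m) 2 c ⟩
  2 * (2 ^ m * c)
    ∎)
  where open ≤-Reasoning
... | no α≢β = *-cancelˡ-≤ 4 (begin
  4 * sum (map (λ v → g (lookup v α) (lookup v β)) (allBits m))
    ≡⟨ sum-allBits-lookup₂ α≢β g ⟩
  2 ^ m * (g false false + g false true + g true false + g true true)
    ≤⟨ *-monoʳ-≤ (2 ^ m) (different α≢β) ⟩
  2 ^ m * (4 * c)
    ≡⟨ x∙yz≈y∙xz (2 ^ m) 4 c ⟩
  4 * (2 ^ m * c)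
    ∎)
  where open ≤-Reasoning

segment : ∀ {k n} → Vec (Fin (suc k)) n → ℕ → ℕ → List (Fin (suc k))
segment x i zero    = []
segment x i (suc m) = pad x i ∷ segment x (suc i) m

module _ {k n} (x : Vec (Fin (suc k)) n) where

  segment-unique : (F : ℕ → ℕ → List (Fin (suc k))) → (∀ i → F i 0 ≡ []) →
    (∀ i m → F i (suc m) ≡ pad x i ∷ F (suc i) m) → ∀ i m → F i m ≡ segment x i m
  segment-unique F nil cons i zero    = nil i
  segment-unique F nil cons i (suc m) =
    trans (cons i m) (cong (pad x i ∷_) (segment-unique F nil cons (suc i) m))

  -- The helper behind `prefix` cannot be named; abstracting its hidden
  -- parameter, its start index and its length lets the unifier take it as F.
  prefix≡segment : ∀ U → prefix x U ≡ segment x 1 U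
  prefix≡segment zero    = refl
  prefix≡segment (suc m) with suc m | segment-unique _ (λ _ → refl) (λ _ _ → refl) | 2 | m
  ... | _ | go≡segment | i | m′ = cong (pad x 1 ∷_) (go≡segment i m′)

  suffix : ℕ → ℕ → List (Fin (suc k))
  suffix U p = segment x p (suc U ∸ p)

  suffix-≤ : ∀ {U p} → p ≤ U → suffix U p ≡ pad x p ∷ suffix U (suc p)
  suffix-≤ {p = p} p≤U = cong (segment x p) (+-∸-assoc 1 p≤U)

  suffix-> : ∀ {U p} → U < p → suffix U p ≡ []
  suffix-> {p = p} U<p = cong (segment x p) (m≤n⇒m∸n≡0 U<p)

module _ {k : ℕ} where

  δ : Fin (suc k) → Fin (suc k) → ℕ
  δ a b = if ⌊ a ≟ᶠ b ⌋ then 0 else 1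

  δ-≢ : ∀ {a b} → a ≢ b → δ a b ≡ 1
  δ-≢ {a} {b} a≢b with a ≟ᶠ b
  ... | yes a≡b = contradiction a≡b a≢b
  ... | no _    = refl

  ed-[]ʳ : ∀ (s : List (Fin (suc k))) → ed s [] ≡ length s
  ed-[]ʳ []      = refl
  ed-[]ʳ (a ∷ s) = refl

  ed-∷-∷ : ∀ a s b r →
    ed (a ∷ s) (b ∷ r) ≡ δ a b + ed s r ⊎
    ed (a ∷ s) (b ∷ r) ≡ suc (ed s (b ∷ r)) ⊎
    ed (a ∷ s) (b ∷ r) ≡ suc (ed (a ∷ s) r)
  ed-∷-∷ a s b r with ⊓-sel (suc (ed s (b ∷ r))) (suc (ed (a ∷ s) r) ⊓ (δ a b + ed s r))
  ... | inj₁ deletion = inj₂ (inj₁ deletion)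
  ... | inj₂ rest with ⊓-sel (suc (ed (a ∷ s) r)) (δ a b + ed s r)
  ...   | inj₁ insertion = inj₂ (inj₂ (trans rest insertion))
  ...   | inj₂ alignment = inj₁ (trans rest alignment)

move : Bool → ℕ → ℕ
move false p = p
move true  p = suc p

+-bit≡move : ∀ b p → p + bit b ≡ move b p
+-bit≡move false p = +-identityʳ p
+-bit≡move true  p = +-comm p 1

module Alignment {k n} (x y : Vec (Fin (suc k)) n) (U V : ℕ) where

  D : ℕ → ℕ → ℕ
  D p j = ed (suffix x U p) (suffix y V j)

  data FirstEdit (p j : ℕ) : Set where
    align     : D p j ≡ δ (pad x p) (pad y j) + D (suc p) (suc j) → FirstEdit p j
    delete    : D p j ≡ suc (D (suc p) j) → FirstEdit p j
    insert    : j ≤ V → D p j ≡ suc (D p (suc j)) → FirstEdit p j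
    exhausted : U < p → V < j → FirstEdit p j

  D-∷-∷ : ∀ {p j} → p ≤ U → j ≤ V →
    D p j ≡ ed (pad x p ∷ suffix x U (suc p)) (pad y j ∷ suffix y V (suc j))
  D-∷-∷ p≤U j≤V = cong₂ ed (suffix-≤ x p≤U) (suffix-≤ y j≤V)

  firstEdit-∷-∷ : ∀ {p j} → p ≤ U → j ≤ V → FirstEdit p j
  firstEdit-∷-∷ {p} {j} p≤U j≤V
    with ed-∷-∷ (pad x p) (suffix x U (suc p)) (pad y j) (suffix y V (suc j))
  ... | inj₁ e        = align (trans (D-∷-∷ p≤U j≤V) e)
  ... | inj₂ (inj₁ e) = delete (trans (D-∷-∷ p≤U j≤V)
          (trans e (cong (λ t → suc (ed (suffix x U (suc p)) t)) (sym (suffix-≤ y j≤V)))))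
  ... | inj₂ (inj₂ e) = insert j≤V (trans (D-∷-∷ p≤U j≤V)
          (trans e (cong (λ s → suc (ed s (suffix y V (suc j)))) (sym (suffix-≤ x p≤U)))))

  firstEdit : ∀ p j → FirstEdit p j
  firstEdit p j with p ≤? U | j ≤? V
  ... | yes p≤U | yes j≤V = firstEdit-∷-∷ p≤U j≤V
  ... | yes p≤U | no  j≰V = delete (begin
    D p j                              ≡⟨ cong₂ ed (suffix-≤ x p≤U) y-done ⟩
    suc (length (suffix x U (suc p)))  ≡⟨ cong suc (ed-[]ʳ (suffix x U (suc p))) ⟨
    suc (ed (suffix x U (suc p)) [])   ≡⟨ cong (λ t → suc (ed (suffix x U (suc p)) t)) y-done ⟨
    suc (D (suc p) j)                  ∎)
    where
    open ≡-Reasoning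
    y-done : suffix y V j ≡ []
    y-done = suffix-> y (≰⇒> j≰V)
  ... | no p≰U  | yes j≤V = insert j≤V (begin
    D p j                              ≡⟨ cong₂ ed x-done (suffix-≤ y j≤V) ⟩
    suc (ed [] (suffix y V (suc j)))   ≡⟨ cong (λ s → suc (ed s (suffix y V (suc j)))) x-done ⟨
    suc (D p (suc j))                  ∎)
    where
    open ≡-Reasoning
    x-done : suffix x U p ≡ []
    x-done = suffix-> x (≰⇒> p≰U)
  ... | no p≰U  | no  j≰V = exhausted (≰⇒> p≰U) (≰⇒> j≰V)

  Φ : ℕ → ℕ → ℕ → ℕ
  Φ p q j = ∣ p - j ∣ + ∣ q - j ∣ + 2 * D p j

  ∣p-q∣≤Φ : ∀ p q j → ∣ p - q ∣ ≤ Φ p q j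
  ∣p-q∣≤Φ p q j = begin
    ∣ p - q ∣              ≤⟨ ∣-∣-triangle p j q ⟩
    ∣ p - j ∣ + ∣ j - q ∣  ≡⟨ cong (∣ p - j ∣ +_) (∣-∣-comm j q) ⟩
    ∣ p - j ∣ + ∣ q - j ∣  ≤⟨ m≤m+n _ (2 * D p j) ⟩
    Φ p q j                ∎
    where open ≤-Reasoning

  record Descent (p q j : ℕ) : Set where
    field
      j₁₀ j₀₁ j₁₁ : ℕ
      matched     : Φ (suc p) (suc q) j₁₁ ≤ Φ p q j
      mismatched  : pad x p ≢ pad y q →
                    Φ p (suc q) j₀₁ + Φ (suc p) q j₁₀ + Φ (suc p) (suc q) j₁₁
                      ≤ 3 * Φ p q j

    next : Bool → Bool → ℕ
    next false false = j
    next true  false = j₁₀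
    next false true  = j₀₁
    next true  true  = j₁₁

    Φ-next : Bool → Bool → ℕ
    Φ-next a b = Φ (move a p) (move b q) (next a b)

    mean-Φ-next-≤ :
      sum (map (λ r → Φ-next (lookup r (pad x p)) (lookup r (pad y q))) (allBits (suc k)))
        ≤ 2 ^ suc k * Φ p q j
    mean-Φ-next-≤ = mean-allBits-≤ (pad x p) (pad y q) Φ-next {Φ p q j}
      (λ _ → m≤n⇒n+m≤2*n matched)
      (λ x≢y → m+n+o≤3*k⇒k+m+n+o≤4*k (Φ p q j) (Φ-next false true) (Φ-next true false)
                                              (Φ-next true true) (mismatched x≢y))

  diagonal-descent : ∀ {p q j} → D (suc p) (suc j) ≤ D p j →
    (q ≡ j → pad x p ≢ pad y q → D (suc p) (suc j) < D p j) → Descent p q j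
  diagonal-descent {p} {q} {j} D′≤D decreases = record
    { j₁₀ = suc j ; j₀₁ = j ; j₁₁ = suc j
    ; matched    = +-monoʳ-≤ (∣ p - j ∣ + ∣ q - j ∣) (*-monoʳ-≤ 2 D′≤D)
    ; mismatched = λ x≢y →
        diagonal-mean-≤ {e = D (suc p) (suc j)} {d = D p j} ∣ p - j ∣ (shifts x≢y)
    }
    where
    open ≤-Reasoning
    shifts : pad x p ≢ pad y q →
      ∣ q - suc j ∣ + ∣ suc q - j ∣ + 4 * D (suc p) (suc j) ≤ 2 * ∣ q - j ∣ + 4 * D p j
    shifts x≢y with q ≟ j
    ... | yes refl = begin
      ∣ q - suc q ∣ + ∣ suc q - q ∣ + 4 * D (suc p) (suc q)
        ≤⟨ +-monoˡ-≤ _ (+-mono-≤ (∣m-1+n∣≤1+∣m-n∣ q q) (∣1+m-n∣≤1+∣m-n∣ q q)) ⟩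
      suc ∣ q - q ∣ + suc ∣ q - q ∣ + 4 * D (suc p) (suc q)
        ≤⟨ m≤m+n _ 2 ⟩
      suc ∣ q - q ∣ + suc ∣ q - q ∣ + 4 * D (suc p) (suc q) + 2
        ≡⟨ identity ∣ q - q ∣ (D (suc p) (suc q)) ⟩
      2 * ∣ q - q ∣ + 4 * suc (D (suc p) (suc q))
        ≤⟨ +-monoʳ-≤ (2 * ∣ q - q ∣) (*-monoʳ-≤ 4 (decreases refl x≢y)) ⟩
      2 * ∣ q - q ∣ + 4 * D p q
        ∎
      where
      identity : ∀ c e → suc c + suc c + 4 * e + 2 ≡ 2 * c + 4 * suc e
      identity = solve-∀
    ... | no q≢j =
      +-mono-≤ (≤-reflexive (∣m-1+n∣+∣1+m-n∣≡2*∣m-n∣ q j q≢j)) (*-monoʳ-≤ 4 D′≤D)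

  align-descent : ∀ {p q j} → D p j ≡ δ (pad x p) (pad y j) + D (suc p) (suc j) → Descent p q j
  align-descent {p} {j = j} D≡ = diagonal-descent (≤-trans (m≤n+m _ _) (≤-reflexive (sym D≡)))
    λ { refl x≢y → ≤-reflexive (sym (trans D≡ (cong (_+ D (suc p) (suc j)) (δ-≢ x≢y)))) }

  exhausted-descent : ∀ {p q j} → p ≤ U ⊎ q ≤ V → U < p → V < j → Descent p q j
  exhausted-descent live U<p V<j = diagonal-descent
    (≤-reflexive (trans (D-exhausted (m<n⇒m<1+n U<p) (m<n⇒m<1+n V<j)) (sym (D-exhausted U<p V<j))))
    λ { refl _ → ⊥-elim ([ <⇒≱ U<p , <⇒≱ V<j ] live) }
    where
    D-exhausted : ∀ {p j} → U < p → V < j → D p j ≡ 0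
    D-exhausted U<p V<j = cong₂ ed (suffix-> x U<p) (suffix-> y V<j)

  deletion-descent : ∀ {p q j} → D p j ≡ suc (D (suc p) j) → Descent p q j
  deletion-descent {p} {q} {j} D≡ = record
    { j₁₀ = j ; j₀₁ = j ; j₁₁ = j
    ; matched    = unit-steps-≤ p-step q-step D≡
    ; mismatched = λ _ → deletion-mean-≤ p-step q-step D≡
    }
    where
    p-step = ∣1+m-n∣≤1+∣m-n∣ p j
    q-step = ∣1+m-n∣≤1+∣m-n∣ q j

  insertion-≤ : ∀ p q j → D p j ≡ suc (D p (suc j)) → Φ p q (suc j) ≤ Φ p q j
  insertion-≤ p q j = unit-steps-≤ (∣m-1+n∣≤1+∣m-n∣ p j) (∣m-1+n∣≤1+∣m-n∣ q j)

  descent : ∀ fuel p q j → suc V ∸ j ≤ fuel → p ≤ U ⊎ q ≤ V →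
            Σ[ j′ ∈ ℕ ] Φ p q j′ ≤ Φ p q j × Descent p q j′
  descent fuel p q j budget live with firstEdit p j
  ... | align D≡           = j , ≤-refl , align-descent D≡
  ... | delete D≡          = j , ≤-refl , deletion-descent D≡
  ... | exhausted U<p V<j  = j , ≤-refl , exhausted-descent live U<p V<j
  ... | insert j≤V D≡ with fuel | subst (_≤ fuel) (+-∸-assoc 1 j≤V) budget
  ...   | suc fuel′ | s≤s budget′ with descent fuel′ p q (suc j) budget′ live
  ...     | j′ , Φ≤ , d = j′ , ≤-trans Φ≤ (insertion-≤ p q j D≡) , d

module Walk {k n} (x y : Vec (Fin (suc k)) n) (U V : ℕ) (stop : ℕ → ℕ → Bool)
            (live : ∀ {p q} → stop p q ≡ false → p ≤ U ⊎ q ≤ V) where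

  open Alignment x y U V

  R : List (Step k)
  R = allBits (suc k)

  M : ℕ
  M = 2 ^ suc k

  scaledTruncExpFrom : ℕ → ℕ → ℕ → ℕ
  scaledTruncExpFrom N p q = sum (map (hitValue stop x y p q) (sequences N R))

  hitValue-stopped : ∀ {p q} → stop p q ≡ true → ∀ rs → hitValue stop x y p q rs ≡ ∣ p - q ∣
  hitValue-stopped stopped []       rewrite stopped = refl
  hitValue-stopped stopped (r ∷ rs) rewrite stopped = refl

  hitValue-∷ : ∀ {p q} → stop p q ≡ false → ∀ r rs →
    hitValue stop x y p q (r ∷ rs)
      ≡ hitValue stop x y (move (lookup r (pad x p)) p) (move (lookup r (pad y q)) q) rs
  hitValue-∷ {p} {q} running r rs
    rewrite running | +-bit≡move (lookup r (pad x p)) p | +-bit≡move (lookup r (pad y q)) q = refl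

  scaledTruncExpFrom-stopped : ∀ {p q} → stop p q ≡ true → ∀ N →
    scaledTruncExpFrom N p q ≡ ∣ p - q ∣ * M ^ N
  scaledTruncExpFrom-stopped {p} {q} stopped N = begin
    sum (map (hitValue stop x y p q) (sequences N R))
      ≡⟨ cong sum (map-cong (hitValue-stopped stopped) (sequences N R)) ⟩
    sum (map (λ _ → ∣ p - q ∣) (sequences N R))
      ≡⟨ sum-map-const ∣ p - q ∣ (sequences N R) ⟩
    length (sequences N R) * ∣ p - q ∣
      ≡⟨ cong (_* ∣ p - q ∣) (length-sequences N R) ⟩
    length R ^ N * ∣ p - q ∣
      ≡⟨ cong (λ l → l ^ N * ∣ p - q ∣) (length-allBits (suc k)) ⟩
    M ^ N * ∣ p - q ∣
      ≡⟨ *-comm (M ^ N) ∣ p - q ∣ ⟩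
    ∣ p - q ∣ * M ^ N
      ∎
    where open ≡-Reasoning

  scaledTruncExpFrom-zero : ∀ {p q} → stop p q ≡ false → scaledTruncExpFrom 0 p q ≡ 0
  scaledTruncExpFrom-zero running rewrite running = refl

  scaledTruncExpFrom-suc : ∀ {p q} → stop p q ≡ false → ∀ N →
    scaledTruncExpFrom (suc N) p q
      ≡ sum (map (λ r → scaledTruncExpFrom N (move (lookup r (pad x p)) p)
                                             (move (lookup r (pad y q)) q)) R)
  scaledTruncExpFrom-suc {p} {q} running N =
    trans (sum-map-sequences (hitValue stop x y p q) N R)
          (cong sum (map-cong (λ r → cong sum (map-cong (hitValue-∷ running r) (sequences N R))) R))

  scaledTruncExpFrom-≤ : ∀ N p q j → scaledTruncExpFrom N p q ≤ Φ p q j * M ^ N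
  scaledTruncExpFrom-≤ N p q j with stop p q in stopped
  ... | true = begin
    scaledTruncExpFrom N p q  ≡⟨ scaledTruncExpFrom-stopped stopped N ⟩
    ∣ p - q ∣ * M ^ N          ≤⟨ *-monoˡ-≤ (M ^ N) (∣p-q∣≤Φ p q j) ⟩
    Φ p q j * M ^ N            ∎
    where open ≤-Reasoning
  scaledTruncExpFrom-≤ zero    p q j | false =
    ≤-trans (≤-reflexive (scaledTruncExpFrom-zero stopped)) z≤n
  scaledTruncExpFrom-≤ (suc N) p q j | false with descent (suc V ∸ j) p q j ≤-refl (live stopped)
  ... | j′ , Φ′≤Φ , d = begin
    scaledTruncExpFrom (suc N) p q
      ≡⟨ scaledTruncExpFrom-suc stopped N ⟩
    sum (map (λ r → scaledTruncExpFrom N (move (lookup r α) p) (move (lookup r β) q)) R)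
      ≤⟨ sum-map-mono (λ r → scaledTruncExpFrom-≤ N _ _ (next (lookup r α) (lookup r β))) R ⟩
    sum (map (λ r → Φ-next (lookup r α) (lookup r β) * M ^ N) R)
      ≡⟨ sum-map-*ʳ (λ r → Φ-next (lookup r α) (lookup r β)) (M ^ N) R ⟩
    sum (map (λ r → Φ-next (lookup r α) (lookup r β)) R) * M ^ N
      ≤⟨ *-monoˡ-≤ (M ^ N) mean-Φ-next-≤ ⟩
    M * Φ p q j′ * M ^ N
      ≤⟨ *-monoˡ-≤ (M ^ N) (*-monoʳ-≤ M Φ′≤Φ) ⟩
    M * Φ p q j * M ^ N
      ≡⟨ *-assoc M (Φ p q j) (M ^ N) ⟩
    M * (Φ p q j * M ^ N)
      ≡⟨ x∙yz≈y∙xz M (Φ p q j) (M ^ N) ⟩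
    Φ p q j * M ^ suc N
      ∎
    where
    open ≤-Reasoning
    open Descent d
    α = pad x p
    β = pad y q

  scaledTruncExp-≤ : ∀ N → scaledTruncExp stop x y N ≤ 2 * ed (prefix x U) (prefix y V) * M ^ N
  scaledTruncExp-≤ N rewrite prefix≡segment x U | prefix≡segment y V = scaledTruncExpFrom-≤ N 1 1 1

≤ᵇ≡false⇒≤∸1 : ∀ u {p} → (u ≤ᵇ p) ≡ false → p ≤ u ∸ 1
≤ᵇ≡false⇒≤∸1 u u≰ᵇp = ∸-monoˡ-≤ 1 (≰⇒> λ (u≤p : u ≤ _) → subst T u≰ᵇp (≤⇒≤ᵇ u≤p))

stop₀-live : ∀ u {U V} → u ∸ 1 ≤ U → ∀ {p q} → stop₀ u p q ≡ false → p ≤ U ⊎ q ≤ V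
stop₀-live u u∸1≤U running = inj₁ (≤-trans (≤ᵇ≡false⇒≤∸1 u running) u∸1≤U)

stop₁-live : ∀ u {U V} → u ∸ 1 ≤ U → u ∸ 1 ≤ V →
  ∀ {p q} → stop₁ u p q ≡ false → p ≤ U ⊎ q ≤ V
stop₁-live u u∸1≤U u∸1≤V {p} running with u ≤ᵇ p in u≤ᵇp
... | true  = inj₂ (≤-trans (≤ᵇ≡false⇒≤∸1 u running) u∸1≤V)
... | false = inj₁ (≤-trans (≤ᵇ≡false⇒≤∸1 u u≤ᵇp) u∸1≤U)

lemma2p13 : (k n : ℕ) (x y : Vec (Fin (suc k)) n) (u U V : ℕ) →
    1 ≤ u → u ∸ 1 ≤ U → u ∸ 1 ≤ V →
    (N : ℕ) →
      (scaledTruncExp (stop₀ u) x y N ≤ 4 * ed (prefix x U) (prefix y V) * (2 ^ suc k) ^ N)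
      × (scaledTruncExp (stop₁ u) x y N ≤ 4 * ed (prefix x U) (prefix y V) * (2 ^ suc k) ^ N)
lemma2p13 k n x y u U V _ u∸1≤U u∸1≤V N =
  ≤-trans (Walk.scaledTruncExp-≤ x y U V (stop₀ u) (stop₀-live u u∸1≤U) N) 2ed≤4ed ,
  ≤-trans (Walk.scaledTruncExp-≤ x y U V (stop₁ u) (stop₁-live u u∸1≤U u∸1≤V) N) 2ed≤4ed
  where
  E = ed (prefix x U) (prefix y V)
  2ed≤4ed : 2 * E * (2 ^ suc k) ^ N ≤ 4 * E * (2 ^ suc k) ^ N
  2ed≤4ed = *-monoˡ-≤ ((2 ^ suc k) ^ N) (*-monoˡ-≤ E (m≤m+n 2 2))
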